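{- If $P$ is a polyomino of minimum size among polyominoes containing at least $8$ instances of the L tromino, then $|P|\ge 13$.
   Context: Cells are the unit squares of the square lattice, indexed by integer coordinates $(x,y)$. A polyomino is a finite nonempty edge-connected set of cells; its size $|P|$ is its number of cells. The L tromino is $\{(0,0),(1,0),(0,1)\}$; an instance is a translate of it, and an instance in $P$ is one contained in $P$. -}

module Defs where

open import Data.Nat using (ℕ; _≤_)
open import Data.Integer using (ℤ; _+_; +_)
open import Data.Product using (_×_; _,_; ∃-syntax)
open import Data.Sum using (_⊎_)
open import Data.List using (List; []; length)
open import Data.List.Membership.Propositional using (_∈_)
open import Data.List.Relation.Unary.All using (All)
open import Data.List.Relation.Unary.Unique.Propositional using (Unique)
open import Relation.Binary.PropositionalEquality using (_≡_; _≢_)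

Cell : Set
Cell = ℤ × ℤ

Adj : Cell → Cell → Set
Adj (x , y) (x' , y') =
  (x' ≡ x + + 1 × y' ≡ y) ⊎ (x ≡ x' + + 1 × y ≡ y') ⊎
  (x' ≡ x × y' ≡ y + + 1) ⊎ (x ≡ x' × y ≡ y' + + 1)

data Reach (S : List Cell) : Cell → Cell → Set where
  here : ∀ {c} → Reach S c c
  step : ∀ {c d e} → Reach S c d → Adj d e → e ∈ S → Reach S c e

EdgeConnected : List Cell → Set
EdgeConnected S = ∀ {c d} → c ∈ S → d ∈ S → Reach S c d

record Polyomino : Set where
  field
    cells     : List Cell
    unique    : Unique cells
    nonempty  : cells ≢ []
    connected : EdgeConnected cells
open Polyomino public

size : Polyomino → ℕ
size P = length (cells P)

LInstanceIn : Polyomino → Cell → Set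
LInstanceIn P (a , b) =
  (a , b) ∈ cells P × (a + + 1 , b) ∈ cells P × (a , b + + 1) ∈ cells P

-- P contains at least k (distinct) instances of the L tromino;
-- instances are identified with their translation vectors.
AtLeastLInstances : ℕ → Polyomino → Set
AtLeastLInstances k P =
  ∃[ ts ] (Unique ts × k ≤ length ts × All (LInstanceIn P) ts)

{-# OPTIONS --safe #-}
-- Identify each instance with its corner t (the translation vector); corners are cells of P.
-- Walking right from a corner, the first cell that is not a corner is still a cell of P,
-- since its left neighbour is a corner; likewise walking up. These two non-corner cells r
-- and u determine t = (x u , y r), and x u < x r. So the n corners inject into the pairs of
-- non-corner cells with distinct x-coordinates, whence n ≤ C(|P| − n, 2); for n ≥ 8 and
-- |P| ≤ 12 this would give 8 ≤ C(4, 2) = 6.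
module Submission where

open import Defs
open import Data.Nat using (_≤_)
open import Data.Product using (_×_)

open import Data.Integer as ℤ using (+_; +<+)
import Data.Integer.Properties as ℤ
open import Algebra.Properties.AbelianGroup ℤ.+-0-abelianGroup using (∙-cancelˡ)
open import Data.List using (List; []; _∷_; _++_; length; map; filter; upTo)
open import Data.List.Membership.Propositional using (_∈_; _∉_)
open import Data.List.Membership.Propositional.Properties
  using (∈-∃++; ∈-map⁺; ∈-filter⁺; ∈-filter⁻; ∈-++⁺ˡ; ∈-++⁺ʳ; ∈-++⁻)
import Data.List.Properties as List
open import Data.List.Relation.Binary.Permutation.Propositional.Properties
  using (shift; ↭-length; ∈-resp-↭)
open import Data.List.Relation.Binary.Subset.Propositional using (_⊆_)
open import Data.List.Relation.Unary.All as All using (All; all?)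
open import Data.List.Relation.Unary.All.Properties using (¬All⇒Any¬)
open import Data.List.Relation.Unary.Any as Any using (here; there)
import Data.List.Relation.Unary.Any.Properties as Any
open import Data.List.Relation.Unary.AllPairs using (_∷_)
open import Data.List.Relation.Unary.Unique.Propositional using (Unique)
import Data.List.Relation.Unary.Unique.Propositional.Properties as Unique
open import Data.Nat as ℕ using (ℕ; zero; suc; z≤n; s≤s; z<s; _<_)
open import Data.Nat.Combinatorics using (_C_; nC1≡n; nCk+nC[k+1]≡[n+1]C[k+1])
import Data.Nat.Properties as ℕ
open import Data.Product using (_,_; proj₁; proj₂; ∃-syntax)
import Data.Product.Properties as Product
open import Data.Sum using (inj₁; inj₂)
open import Function using (_∘′_; _on_; Injective)
open import Level using (0ℓ)
open import Relation.Binary using (Rel; Asymmetric; Decidable; DecidableEquality)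
open import Relation.Binary.PropositionalEquality
open import Relation.Nullary using (¬_; yes; no; contradiction)
open import Relation.Nullary.Decidable using (from-no)
import Relation.Unary as U

unique-⊆⇒length≤ : {A : Set} {xs ys : List A} → Unique xs → xs ⊆ ys → length xs ≤ length ys
unique-⊆⇒length≤ {xs = []} _ _ = z≤n
unique-⊆⇒length≤ {xs = x ∷ xs} {ys} x∷xs-unique@(_ ∷ xs-unique) x∷xs⊆ys
  with as , bs , refl ← ∈-∃++ (x∷xs⊆ys (here refl)) = begin
    suc (length xs)         ≤⟨ s≤s (unique-⊆⇒length≤ xs-unique xs⊆as++bs) ⟩
    suc (length (as ++ bs)) ≡⟨ ↭-length (shift x as bs) ⟨
    length ys               ∎
  where
  open ℕ.≤-Reasoning
  xs⊆as++bs : xs ⊆ as ++ bs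
  xs⊆as++bs y∈xs with ∈-resp-↭ (shift x as bs) (x∷xs⊆ys (there y∈xs))
  ... | here refl       = contradiction y∈xs (Unique.Unique[x∷xs]⇒x∉xs x∷xs-unique)
  ... | there y∈as++bs  = y∈as++bs

length-filter-disjoint : {A : Set} {P Q : U.Pred A 0ℓ} (P? : U.Decidable P) (Q? : U.Decidable Q) →
  (∀ {x} → P x → ¬ Q x) → ∀ xs → length (filter P? xs) ℕ.+ length (filter Q? xs) ≤ length xs
length-filter-disjoint P? Q? disjoint []       = z≤n
length-filter-disjoint P? Q? disjoint (x ∷ xs) with P? x | Q? x
... | yes p | yes q = contradiction q (disjoint p)
... | yes _ | no _  = s≤s (length-filter-disjoint P? Q? disjoint xs)
... | no _  | yes _ =
  ℕ.≤-trans (ℕ.≤-reflexive (ℕ.+-suc _ _)) (s≤s (length-filter-disjoint P? Q? disjoint xs))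
... | no _  | no _  = ℕ.m≤n⇒m≤1+n (length-filter-disjoint P? Q? disjoint xs)

module AscendingPairs {A : Set} {_≺_ : Rel A 0ℓ} (≺-asym : Asymmetric _≺_) (_≺?_ : Decidable _≺_) where

  ascendingPairs : List A → List (A × A)
  ascendingPairs []       = []
  ascendingPairs (a ∷ xs) =
    map (a ,_) (filter (a ≺?_) xs) ++ map (_, a) (filter (_≺? a) xs) ++ ascendingPairs xs

  ∈-ascendingPairs : ∀ {a b xs} → a ∈ xs → b ∈ xs → a ≺ b → (a , b) ∈ ascendingPairs xs
  ∈-ascendingPairs (here refl) (here refl) a≺a = contradiction a≺a (≺-asym a≺a)
  ∈-ascendingPairs {xs = a ∷ xs} (here refl) (there b∈xs) a≺b =
    ∈-++⁺ˡ (∈-map⁺ (a ,_) (∈-filter⁺ (a ≺?_) b∈xs a≺b))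
  ∈-ascendingPairs {xs = b ∷ xs} (there a∈xs) (here refl) a≺b =
    ∈-++⁺ʳ (map (b ,_) (filter (b ≺?_) xs)) (∈-++⁺ˡ (∈-map⁺ (_, b) (∈-filter⁺ (_≺? b) a∈xs a≺b)))
  ∈-ascendingPairs {xs = c ∷ xs} (there a∈xs) (there b∈xs) a≺b =
    ∈-++⁺ʳ (map (c ,_) (filter (c ≺?_) xs)) (∈-++⁺ʳ (map (_, c) (filter (_≺? c) xs))
      (∈-ascendingPairs a∈xs b∈xs a≺b))

  length-ascendingPairs : ∀ xs → length (ascendingPairs xs) ≤ length xs C 2
  length-ascendingPairs []       = z≤n
  length-ascendingPairs (a ∷ xs) = begin
    length (map (a ,_) above ++ map (_, a) below ++ ascendingPairs xs)
      ≡⟨ List.length-++ (map (a ,_) above) ⟩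
    length (map (a ,_) above) ℕ.+ length (map (_, a) below ++ ascendingPairs xs)
      ≡⟨ cong₂ ℕ._+_ (List.length-map (a ,_) above) (List.length-++ (map (_, a) below)) ⟩
    length above ℕ.+ (length (map (_, a) below) ℕ.+ length (ascendingPairs xs))
      ≡⟨ cong (λ n → length above ℕ.+ (n ℕ.+ _)) (List.length-map (_, a) below) ⟩
    length above ℕ.+ (length below ℕ.+ length (ascendingPairs xs))
      ≡⟨ ℕ.+-assoc (length above) _ _ ⟨
    length above ℕ.+ length below ℕ.+ length (ascendingPairs xs)
      ≤⟨ ℕ.+-mono-≤ (length-filter-disjoint (a ≺?_) (_≺? a) ≺-asym xs)
                    (length-ascendingPairs xs) ⟩
    length xs ℕ.+ length xs C 2
      ≡⟨ cong (ℕ._+ length xs C 2) (nC1≡n (length xs)) ⟨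
    length xs C 1 ℕ.+ length xs C 2
      ≡⟨ nCk+nC[k+1]≡[n+1]C[k+1] (length xs) 1 ⟩
    suc (length xs) C 2 ∎
    where
    open ℕ.≤-Reasoning
    above below : List A
    above = filter (a ≺?_) xs
    below = filter (_≺? a) xs

module _ {A : Set} (_≟_ : DecidableEquality A) where

  open import Data.List.Membership.DecPropositional _≟_ using (_∈?_)

  injective⇒∃∉ : (f : ℕ → A) → Injective _≡_ _≡_ f → ∀ xs → ∃[ n ] f n ∉ xs
  injective⇒∃∉ f f-inj xs with all? (_∈? xs) (map f (upTo (suc (length xs))))
  ... | no ¬all∈ = Any.satisfied (Any.map⁻ (¬All⇒Any¬ (_∈? xs) _ ¬all∈))
  ... | yes all∈ =
    contradiction (unique-⊆⇒length≤ prefix-unique (All.lookup all∈)) (ℕ.<⇒≱ prefix-longer)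
    where
    prefix : List A
    prefix = map f (upTo (suc (length xs)))
    prefix-unique : Unique prefix
    prefix-unique = Unique.map⁺ f-inj (Unique.upTo⁺ (suc (length xs)))
    |prefix| : length prefix ≡ suc (length xs)
    |prefix| = trans (List.length-map f (upTo (suc (length xs)))) (List.length-upTo _)
    prefix-longer : length xs < length prefix
    prefix-longer = subst (length xs <_) (sym |prefix|) (ℕ.n<1+n (length xs))

  exit-before : ∀ {xs} (f : ℕ → A) n → f 0 ∈ xs → f n ∉ xs → ∃[ m ] (f m ∈ xs × f (suc m) ∉ xs)
  exit-before f zero    f0∈xs f0∉xs = contradiction f0∈xs f0∉xs
  exit-before {xs} f (suc n) f0∈xs fn+1∉xs with f n ∈? xs
  ... | yes fn∈xs = n , fn∈xs , fn+1∉xs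
  ... | no  fn∉xs = exit-before f n f0∈xs fn∉xs

  injective⇒exit : ∀ {xs} (f : ℕ → A) → Injective _≡_ _≡_ f → f 0 ∈ xs →
                   ∃[ m ] (f m ∈ xs × f (suc m) ∉ xs)
  injective⇒exit {xs} f f-inj f0∈xs with n , fn∉xs ← injective⇒∃∉ f f-inj xs =
    exit-before f n f0∈xs fn∉xs

_≟ᶜ_ : DecidableEquality Cell
_≟ᶜ_ = Product.≡-dec ℤ._≟_ ℤ._≟_

open import Data.List.Membership.DecPropositional _≟ᶜ_ using (_∉?_)

i+[1+n]≡i+n+1 : ∀ i n → i ℤ.+ + suc n ≡ i ℤ.+ + n ℤ.+ + 1
i+[1+n]≡i+n+1 i n = begin
  i ℤ.+ + suc n         ≡⟨ cong (λ j → i ℤ.+ j) (ℤ.+-comm (+ 1) (+ n)) ⟩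
  i ℤ.+ (+ n ℤ.+ + 1)   ≡⟨ ℤ.+-assoc i (+ n) (+ 1) ⟨
  i ℤ.+ + n ℤ.+ + 1     ∎
  where open ≡-Reasoning

i+-injective : ∀ i → Injective _≡_ _≡_ (λ n → i ℤ.+ + n)
i+-injective i = ℤ.+-injective ∘′ ∙-cancelˡ i _ _

i<i+[1+n] : ∀ i n → i ℤ.< i ℤ.+ + suc n
i<i+[1+n] i n = subst (ℤ._< i ℤ.+ + suc n) (ℤ.+-identityʳ i) (ℤ.+-monoʳ-< i (+<+ z<s))

row column : Cell → ℕ → Cell
row    (x , y) k = (x ℤ.+ + k , y)
column (x , y) k = (x , y ℤ.+ + k)

row-zero : ∀ c → row c 0 ≡ c
row-zero (x , y) = cong (_, y) (ℤ.+-identityʳ x)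

column-zero : ∀ c → column c 0 ≡ c
column-zero (x , y) = cong (x ,_) (ℤ.+-identityʳ y)

row-injective : ∀ c → Injective _≡_ _≡_ (row c)
row-injective (x , y) = i+-injective x ∘′ cong proj₁

column-injective : ∀ c → Injective _≡_ _≡_ (column c)
column-injective (x , y) = i+-injective y ∘′ cong proj₂

nonCorners : Polyomino → List Cell → List Cell
nonCorners P ts = filter (_∉? ts) (cells P)

module _ (P : Polyomino) {ts : List Cell} (ts-instances : All (LInstanceIn P) ts) where

  row-exit : ∀ {t} → t ∈ ts → ∃[ n ] row t (suc n) ∈ nonCorners P ts
  row-exit {t} t∈ts
    with m , row-m∈ts , row-m+1∉ts ←
           injective⇒exit _≟ᶜ_ (row t) (row-injective t)
             (subst (_∈ ts) (sym (row-zero t)) t∈ts)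
    = m , ∈-filter⁺ (_∉? ts) right∈P row-m+1∉ts
    where
    right∈P : row t (suc m) ∈ cells P
    right∈P = subst (λ x → (x , proj₂ t) ∈ cells P) (sym (i+[1+n]≡i+n+1 (proj₁ t) m))
      (proj₁ (proj₂ (All.lookup ts-instances row-m∈ts)))

  column-exit : ∀ {t} → t ∈ ts → ∃[ n ] column t (suc n) ∈ nonCorners P ts
  column-exit {t} t∈ts
    with m , column-m∈ts , column-m+1∉ts ←
           injective⇒exit _≟ᶜ_ (column t) (column-injective t)
             (subst (_∈ ts) (sym (column-zero t)) t∈ts)
    = m , ∈-filter⁺ (_∉? ts) up∈P column-m+1∉ts
    where
    up∈P : column t (suc m) ∈ cells P
    up∈P = subst (λ y → (proj₁ t , y) ∈ cells P) (sym (i+[1+n]≡i+n+1 (proj₂ t) m))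
      (proj₂ (proj₂ (All.lookup ts-instances column-m∈ts)))

  length-corners≤C2 : Unique ts → length ts ≤ length (nonCorners P ts) C 2
  length-corners≤C2 ts-unique = begin
    length ts                          ≤⟨ unique-⊆⇒length≤ ts-unique ts⊆decoded ⟩
    length (map decode pairs)          ≡⟨ List.length-map decode pairs ⟩
    length pairs                       ≤⟨ length-ascendingPairs (nonCorners P ts) ⟩
    length (nonCorners P ts) C 2       ∎
    where
    open ℕ.≤-Reasoning
    open AscendingPairs {_≺_ = ℤ._<_ on proj₁} ℤ.<-asym (λ c d → proj₁ c ℤ.<? proj₁ d)
    pairs : List (Cell × Cell)
    pairs = ascendingPairs (nonCorners P ts)
    decode : Cell × Cell → Cell
    decode (u , r) = (proj₁ u , proj₂ r)
    ts⊆decoded : ts ⊆ map decode pairs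
    ts⊆decoded {t} t∈ts with m , up∈ ← column-exit t∈ts | n , right∈ ← row-exit t∈ts =
      ∈-map⁺ decode (∈-ascendingPairs up∈ right∈ (i<i+[1+n] (proj₁ t) n))

  length-corners+nonCorners≤size : Unique ts → length ts ℕ.+ length (nonCorners P ts) ≤ size P
  length-corners+nonCorners≤size ts-unique = begin
    length ts ℕ.+ length (nonCorners P ts) ≡⟨ List.length-++ ts ⟨
    length (ts ++ nonCorners P ts)         ≤⟨ unique-⊆⇒length≤ ts++nonCorners-unique ⊆cells ⟩
    size P                                 ∎
    where
    open ℕ.≤-Reasoning
    disjoint : ∀ {c} → ¬ (c ∈ ts × c ∈ nonCorners P ts)
    disjoint (c∈ts , c∈nonCorners) = proj₂ (∈-filter⁻ (_∉? ts) {xs = cells P} c∈nonCorners) c∈ts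
    ts++nonCorners-unique : Unique (ts ++ nonCorners P ts)
    ts++nonCorners-unique = Unique.++⁺ ts-unique (Unique.filter⁺ (_∉? ts) (unique P)) disjoint
    ⊆cells : ts ++ nonCorners P ts ⊆ cells P
    ⊆cells c∈ with ∈-++⁻ ts c∈
    ... | inj₁ c∈ts         = proj₁ (All.lookup ts-instances c∈ts)
    ... | inj₂ c∈nonCorners = proj₁ (∈-filter⁻ (_∉? ts) {xs = cells P} c∈nonCorners)

[≤4]C2≤6 : ∀ k → k ≤ 4 → k C 2 ≤ 6
[≤4]C2≤6 0 _ = z≤n
[≤4]C2≤6 1 _ = z≤n
[≤4]C2≤6 2 _ = s≤s z≤n
[≤4]C2≤6 3 _ = s≤s (s≤s (s≤s z≤n))
[≤4]C2≤6 4 _ = ℕ.≤-refl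
[≤4]C2≤6 (suc (suc (suc (suc (suc _))))) (s≤s (s≤s (s≤s (s≤s ()))))

lemma7p4 : (P : Polyomino) →
    AtLeastLInstances 8 P →
    ((Q : Polyomino) → AtLeastLInstances 8 Q → size P ≤ size Q) →
    13 ≤ size P
lemma7p4 P (ts , ts-unique , 8≤|ts| , ts-instances) _ = ℕ.≮⇒≥ λ size<13 →
  from-no (8 ℕ.≤? 6) (begin
    8             ≤⟨ 8≤|ts| ⟩
    length ts     ≤⟨ length-corners≤C2 P ts-instances ts-unique ⟩
    length B C 2  ≤⟨ [≤4]C2≤6 (length B) (|B|≤4 (ℕ.≤-pred size<13)) ⟩
    6             ∎)
  where
  open ℕ.≤-Reasoning
  B : List Cell
  B = nonCorners P ts
  |B|≤4 : size P ≤ 12 → length B ≤ 4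
  |B|≤4 size≤12 = ℕ.+-cancelˡ-≤ 8 (length B) 4 (begin
    8 ℕ.+ length B          ≤⟨ ℕ.+-monoˡ-≤ (length B) 8≤|ts| ⟩
    length ts ℕ.+ length B  ≤⟨ length-corners+nonCorners≤size P ts-instances ts-unique ⟩
    size P                  ≤⟨ size≤12 ⟩
    12                      ∎)
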